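{- Let $n\ge1$. The poset $P_n$ is self-dual, i.e., it is isomorphic to its dual poset.
   Context: $P_n$ is the set of 132-avoiding permutations $p=p_1\cdots p_n$ of $[n]$ (no indices $i<j<k$ with $p_i<p_k<p_j$), partially ordered by $x<y$ iff $D(x)\subsetneq D(y)$, where $D(p)=\{i\in[n-1]:p_i>p_{i+1}\}$ is the descent set of $p$. -}

module Defs where

open import Data.Nat using (ℕ; suc)
open import Data.Fin using (Fin; toℕ; _<_)
open import Data.Vec using (Vec; lookup)
open import Data.Product using (Σ; ∃; ∃-syntax; _×_; _,_)
open import Relation.Nullary using (¬_)
open import Relation.Binary.PropositionalEquality using (_≡_)
open import Function.Bundles using (_⤖_; _⇔_; Bijection)

-- A permutation p = p₁⋯pₙ of [n], written in one-line notation as a vector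
-- (positions and values both indexed by Fin n, i.e. [n] shifted to 0-based).
IsPerm : ∀ {n} → Vec (Fin n) n → Set
IsPerm {n} p = ∀ (i j : Fin n) → lookup p i ≡ lookup p j → i ≡ j

Contains132 : ∀ {n} → Vec (Fin n) n → Set
Contains132 {n} p =
  ∃[ i ] ∃[ j ] ∃[ k ] ((i < j) × (j < k) × (lookup p i < lookup p k) × (lookup p k < lookup p j))

Avoids132 : ∀ {n} → Vec (Fin n) n → Set
Avoids132 p = ¬ Contains132 p

-- Elements of P_n: 132-avoiding permutations of [n].  The proofs are irrelevant,
-- so two elements are equal iff their underlying words are equal.
record P (n : ℕ) : Set where
  constructor mkP
  field
    word : Vec (Fin n) n
    .isPerm : IsPerm word
    .avoids : Avoids132 word
open P public

InDescent : ∀ {n} → Vec (Fin n) n → Fin n → Set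
InDescent {n} p i = ∃[ j ] ((toℕ j ≡ suc (toℕ i)) × (lookup p j < lookup p i))

_<P_ : ∀ {n} → P n → P n → Set
_<P_ {n} x y =
  (∀ (i : Fin n) → InDescent (word x) i → InDescent (word y) i)
  × (∃[ i ] (InDescent (word y) i × ¬ InDescent (word x) i))

SelfDual : ℕ → Set
SelfDual n = Σ (P n ⤖ P n) λ φ →
  ∀ (x y : P n) → (x <P y) ⇔ (Bijection.to φ y <P Bijection.to φ x)

-- A binary tree t on n nodes spells a 132-avoiding permutation of {0, …, n-1}: its first letter
-- is the total size of the right subtrees hanging off the left spine, and the remaining letters
-- are the word of t with its leftmost node deleted, punched around the first letter.  Every
-- 132-avoiding word arises from exactly one tree: its second letter exceeds the first by at most
-- one, which is what reinserting a leftmost node requires.  Position i is a descent iff the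
-- i-th node in in-order has a right child.  Mirroring a tree reverses the in-order and swaps
-- left and right children, so it sends the descent set D to {n - 2 - i : i ∉ D}; this map is
-- an involution on subsets of {0, …, n-2} that reverses strict inclusion.

module Submission where

open import Defs
open import Data.Bool using (Bool; true; false; not)
open import Data.Bool.Properties using (not-involutive)
open import Data.Empty using (⊥; ⊥-elim)
open import Data.Fin as Fin using (Fin; toℕ; fromℕ<)
open import Data.Fin.Properties using (toℕ-fromℕ<; toℕ-injective; toℕ<n; any?; punchOut-injective; injective⇒≤)
open import Data.List using (List; []; _∷_; _++_; map; reverse; length)
open import Data.List.Properties
  using (++-assoc; ++-identityʳ; map-++; length-++; length-reverse; unfold-reverse; reverse-++)
open import Data.Nat using (ℕ; zero; suc; _+_; _∸_; _<_; _≤_; _≥_; z≤n; s≤s; z<s; s≤s⁻¹; s<s⁻¹; pred)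
open import Data.Nat.Properties
open import Data.Product using (∃; ∃-syntax; _×_; _,_; proj₁; proj₂; swap)
open import Data.Vec using (Vec; []; _∷_; lookup; tabulate)
open import Data.Vec.Properties using (lookup∘tabulate; tabulate∘lookup; tabulate-cong)
open import Function.Base using (id; _$_)
open import Function.Bundles using (_⇔_; mk⇔; Equivalence; mk↔ₛ′)
open import Function.Properties.Equivalence using (⇔-setoid)
open import Function.Properties.Inverse using (↔⇒⤖)
open import Level using (0ℓ)
open import Relation.Binary using (tri<; tri≈; tri>)
open import Relation.Binary.PropositionalEquality
import Relation.Binary.Reasoning.Setoid as SetoidReasoning
open import Relation.Nullary using (¬_; yes; no; contradiction)
open import Relation.Nullary.Decidable using (recompute)
open import Relation.Nullary.Recomputable using (¬-recompute)
open import Relation.Unary using (Pred; _⊆′_; _≐′_; _∖_; _⊢_; Satisfiable)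

module ⇔-Reasoning = SetoidReasoning (⇔-setoid 0ℓ)

punchIn : ℕ → ℕ → ℕ
punchIn k v with v <? k
... | yes _ = v
... | no _ = suc v

punchOut : ℕ → ℕ → ℕ
punchOut k v with k <? v
... | yes _ = pred v
... | no _ = v

module _ {k v : ℕ} where

  punchIn-< : v < k → punchIn k v ≡ v
  punchIn-< v<k with v <? k
  ... | yes _ = refl
  ... | no v≮k = contradiction v<k v≮k

  punchIn-≥ : k ≤ v → punchIn k v ≡ suc v
  punchIn-≥ k≤v with v <? k
  ... | yes v<k = contradiction k≤v (<⇒≱ v<k)
  ... | no _ = refl

  punchOut-> : k < v → punchOut k v ≡ pred v
  punchOut-> k<v with k <? v
  ... | yes _ = refl
  ... | no k≮v = contradiction k<v k≮v

  punchOut-≤ : v ≤ k → punchOut k v ≡ v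
  punchOut-≤ v≤k with k <? v
  ... | yes k<v = contradiction v≤k (<⇒≱ k<v)
  ... | no _ = refl

punchInᵢ≢i : ∀ k v → punchIn k v ≢ k
punchInᵢ≢i k v with v <? k
... | yes v<k = <⇒≢ v<k
... | no v≮k = λ { refl → v≮k ≤-refl }

punchOut-punchIn : ∀ k v → punchOut k (punchIn k v) ≡ v
punchOut-punchIn k v with v <? k
... | yes v<k = punchOut-≤ (<⇒≤ v<k)
... | no v≮k = punchOut-> (s≤s (≮⇒≥ v≮k))

punchIn-punchOut : ∀ k v → v ≢ k → punchIn k (punchOut k v) ≡ v
punchIn-punchOut k v v≢k with k <? v
punchIn-punchOut k (suc v) _ | yes k<v = punchIn-≥ (s≤s⁻¹ k<v)
... | no k≮v = punchIn-< (≤∧≢⇒< (≮⇒≥ k≮v) v≢k)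

punchIn-injective : ∀ k {a b} → punchIn k a ≡ punchIn k b → a ≡ b
punchIn-injective k {a} {b} eq = begin
  a                          ≡⟨ punchOut-punchIn k a ⟨
  punchOut k (punchIn k a)   ≡⟨ cong (punchOut k) eq ⟩
  punchOut k (punchIn k b)   ≡⟨ punchOut-punchIn k b ⟩
  b                          ∎
  where open ≡-Reasoning

punchIn-mono-< : ∀ k {a b} → a < b → punchIn k a < punchIn k b
punchIn-mono-< k {a} {b} a<b with a <? k | b <? k
... | yes _   | yes _ = a<b
... | yes _   | no _  = m<n⇒m<1+n a<b
... | no a≮k  | yes b<k = contradiction (<-trans a<b b<k) a≮k
... | no _    | no _  = s≤s a<b

punchIn-cancel-< : ∀ k {a b} → punchIn k a < punchIn k b → a < b
punchIn-cancel-< k {a} {b} p with <-cmp a b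
... | tri< a<b _ _ = a<b
... | tri≈ _ refl _ = contradiction p (<-irrefl refl)
... | tri> _ _ b<a = contradiction p (<⇒≯ (punchIn-mono-< k b<a))

punchIn-<⇔ : ∀ k {a b} → punchIn k a < punchIn k b ⇔ a < b
punchIn-<⇔ k = mk⇔ (punchIn-cancel-< k) (punchIn-mono-< k)

punchIn<pivot⇔ : ∀ k v → punchIn k v < k ⇔ v < k
punchIn<pivot⇔ k v with v <? k
... | yes _ = mk⇔ id id
... | no v≮k = mk⇔ (λ p → contradiction (<-trans (n<1+n v) p) v≮k) (λ v<k → contradiction v<k v≮k)

pivot<punchIn⇒pivot≤ : ∀ k v → k < punchIn k v → k ≤ v
pivot<punchIn⇒pivot≤ k v p with v <? k
... | yes v<k = contradiction (<-trans p v<k) (<-irrefl refl)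
... | no v≮k = ≮⇒≥ v≮k

punchOut-≤-pivot : ∀ k v → v ≤ suc k → punchOut k v ≤ k
punchOut-≤-pivot k v v≤1+k with k <? v
punchOut-≤-pivot k (suc v) v≤1+k | yes _ = s≤s⁻¹ v≤1+k
... | no k≮v = ≮⇒≥ k≮v

punchIn-bounded : ∀ {n} k {v} → v < n → punchIn k v < suc n
punchIn-bounded k {v} v<n with v <? k
... | yes _ = m<n⇒m<1+n v<n
... | no _ = s≤s v<n

punchOut-bounded : ∀ {n k v} → k < suc n → v < suc n → v ≢ k → punchOut k v < n
punchOut-bounded {n} {k} {v} k<1+n v<1+n v≢k with k <? v
punchOut-bounded {v = suc v} _ v<1+n _ | yes _ = s≤s⁻¹ v<1+n
... | no k≮v = <-≤-trans (≤∧≢⇒< (≮⇒≥ k≮v) v≢k) (s≤s⁻¹ k<1+n)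

private
  variable
    A B : Set
    X X′ Y Y′ : Pred A 0ℓ

_⊊_ : Pred A 0ℓ → Pred A 0ℓ → Set
X ⊊ Y = X ⊆′ Y × Satisfiable (Y ∖ X)

⊊-respects : X ≐′ X′ → Y ≐′ Y′ → X ⊊ Y → X′ ⊊ Y′
⊊-respects (X⊆X′ , X′⊆X) (Y⊆Y′ , Y′⊆Y) (X⊆Y , a , Ya , ¬Xa) =
  (λ a X′a → Y⊆Y′ a (X⊆Y a (X′⊆X a X′a))) , a , Y⊆Y′ a Ya , (λ X′a → ¬Xa (X′⊆X a X′a))

⊊-cong : X ≐′ X′ → Y ≐′ Y′ → X ⊊ Y ⇔ X′ ⊊ Y′
⊊-cong X≐X′ Y≐Y′ = mk⇔ (⊊-respects X≐X′ Y≐Y′) (⊊-respects (swap X≐X′) (swap Y≐Y′))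

⊊-preimage⇔ : (f : A → B) →
              (∀ b → X b → ∃ λ a → f a ≡ b) → (∀ b → Y b → ∃ λ a → f a ≡ b) →
              (f ⊢ X) ⊊ (f ⊢ Y) ⇔ X ⊊ Y
⊊-preimage⇔ {X = X} {Y = Y} f X⊆image Y⊆image = mk⇔ to from
  where
  to : (f ⊢ X) ⊊ (f ⊢ Y) → X ⊊ Y
  to (X⊆Y , a , Yfa , ¬Xfa) = (λ b Xb → ⊆-at-image (X⊆image b Xb) Xb) , f a , Yfa , ¬Xfa
    where
    ⊆-at-image : ∀ {b} → (∃ λ a → f a ≡ b) → X b → Y b
    ⊆-at-image (a , refl) = X⊆Y a
  from : X ⊊ Y → (f ⊢ X) ⊊ (f ⊢ Y)
  from (X⊆Y , b , Yb , ¬Xb) = (λ a → X⊆Y (f a)) , witness (Y⊆image b Yb) Yb ¬Xb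
    where
    witness : ∀ {b} → (∃ λ a → f a ≡ b) → Y b → ¬ X b → Satisfiable ((f ⊢ Y) ∖ (f ⊢ X))
    witness (a , refl) Yb ¬Xb = a , Yb , ¬Xb

support : ℕ → (ℕ → Bool) → Pred ℕ 0ℓ
support N a m = m < N × a m ≡ true

reflect : ℕ → (ℕ → Bool) → ℕ → Bool
reflect N a m = not (a (N ∸ suc m))

support-cong : ∀ {N a b} → (∀ {m} → m < N → a m ≡ b m) → support N a ≐′ support N b
support-cong a≗b = (λ m (m<N , am) → m<N , trans (sym (a≗b m<N)) am)
                 , (λ m (m<N , bm) → m<N , trans (a≗b m<N) bm)

∸-reflect-involutive : ∀ {N m} → m < N → N ∸ suc (N ∸ suc m) ≡ m
∸-reflect-involutive {suc N} m<1+N = m∸[m∸n]≡n (s≤s⁻¹ m<1+N)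

reflect-involutive : ∀ N a {m} → m < N → reflect N (reflect N a) m ≡ a m
reflect-involutive N a m<N = trans (not-involutive _) (cong a (∸-reflect-involutive m<N))

not≡true⇔ : ∀ b → not b ≡ true ⇔ b ≢ true
not≡true⇔ true = mk⇔ (λ ()) (λ b≢true → contradiction refl b≢true)
not≡true⇔ false = mk⇔ (λ _ ()) (λ _ → refl)

reflect-⊊ : ∀ {N a b} → support N a ⊊ support N b → support N (reflect N b) ⊊ support N (reflect N a)
reflect-⊊ {N} {a} {b} (a⊆b , m , (m<N , bm) , ¬am) = reflect-⊆ , N ∸ suc m , (m′<N m<N , reflect-a) , ¬reflect-b
  where
  m′<N : ∀ {m} → m < N → N ∸ suc m < N
  m′<N = ∸-monoʳ-< z<s
  reflect-⊆ : support N (reflect N b) ⊆′ support N (reflect N a)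
  reflect-⊆ k (k<N , ¬bk′) = k<N , Equivalence.from (not≡true⇔ _) λ ak′ →
    Equivalence.to (not≡true⇔ _) ¬bk′ (proj₂ (a⊆b _ (m′<N k<N , ak′)))
  reflect-a : reflect N a (N ∸ suc m) ≡ true
  reflect-a = Equivalence.from (not≡true⇔ _) λ am′ →
    ¬am (m<N , subst (λ i → a i ≡ true) (∸-reflect-involutive m<N) am′)
  ¬reflect-b : ¬ support N (reflect N b) (N ∸ suc m)
  ¬reflect-b (_ , ¬bm′) =
    Equivalence.to (not≡true⇔ _) ¬bm′ (subst (λ i → b i ≡ true) (sym (∸-reflect-involutive m<N)) bm)

reflect-⊊⇔ : ∀ {N a b} → support N a ⊊ support N b ⇔ support N (reflect N b) ⊊ support N (reflect N a)
reflect-⊊⇔ {N} {a} {b} = mk⇔ reflect-⊊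
  (λ reflected → ⊊-respects (reflect² a) (reflect² b) (reflect-⊊ reflected))
  where
  reflect² : ∀ a → support N (reflect N (reflect N a)) ≐′ support N a
  reflect² a = support-cong (reflect-involutive N a)

-- Binary trees and the words they spell

data Tree : Set where
  leaf : Tree
  node : Tree → Tree → Tree

size : Tree → ℕ
size leaf = 0
size (node l r) = suc (size l + size r)

isNode : Tree → Bool
isNode leaf = false
isNode (node _ _) = true

mirror : Tree → Tree
mirror leaf = leaf
mirror (node l r) = node (mirror r) (mirror l)

firstLetter : Tree → ℕ
firstLetter leaf = 0
firstLetter (node l r) = firstLetter l + size r

dropLeftmost : Tree → Tree
dropLeftmost leaf = leaf
dropLeftmost (node leaf r) = r
dropLeftmost (node l@(node _ _) r) = node (dropLeftmost l) r

insertLeftmost : ℕ → Tree → Tree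
insertLeftmost k leaf = node leaf leaf
insertLeftmost k t@(node l r) with size t ≤? k
... | yes _ = node leaf t
... | no _ = node (insertLeftmost (k ∸ size r) l) r

treeWord : Tree → ℕ → ℕ
treeWord t zero = firstLetter t
treeWord t (suc i) = punchIn (firstLetter t) (treeWord (dropLeftmost t) i)

size-mirror : ∀ t → size (mirror t) ≡ size t
size-mirror leaf = refl
size-mirror (node l r) rewrite size-mirror l | size-mirror r = cong suc (+-comm (size r) (size l))

mirror-involutive : ∀ t → mirror (mirror t) ≡ t
mirror-involutive leaf = refl
mirror-involutive (node l r) = cong₂ node (mirror-involutive l) (mirror-involutive r)

size-dropLeftmost : ∀ t → size (dropLeftmost t) ≡ pred (size t)
size-dropLeftmost leaf = refl
size-dropLeftmost (node leaf r) = refl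
size-dropLeftmost (node l@(node _ _) r) = cong (λ s → suc (s + size r)) (size-dropLeftmost l)

size-insertLeftmost : ∀ k t → size (insertLeftmost k t) ≡ suc (size t)
size-insertLeftmost k leaf = refl
size-insertLeftmost k t@(node l r) with size t ≤? k
... | yes _ = refl
... | no _ = cong (λ s → suc (s + size r)) (size-insertLeftmost (k ∸ size r) l)

firstLetter<size : ∀ l r → firstLetter (node l r) < size (node l r)
firstLetter<size leaf r = s≤s ≤-refl
firstLetter<size (node a b) r = s≤s (+-monoˡ-≤ (size r) (≤-trans (n≤1+n _) (firstLetter<size a b)))

firstLetter≤size : ∀ t → firstLetter t ≤ size t
firstLetter≤size leaf = z≤n
firstLetter≤size (node l r) = <⇒≤ (firstLetter<size l r)

firstLetter-dropLeftmost : ∀ t → firstLetter (dropLeftmost t) ≤ firstLetter t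
firstLetter-dropLeftmost leaf = z≤n
firstLetter-dropLeftmost (node leaf r) = firstLetter≤size r
firstLetter-dropLeftmost (node l@(node _ _) r) = +-monoˡ-≤ (size r) (firstLetter-dropLeftmost l)

dropLeftmost-node : ∀ l r → isNode l ≡ true → dropLeftmost (node l r) ≡ node (dropLeftmost l) r
dropLeftmost-node (node _ _) r _ = refl

isNode-insertLeftmost : ∀ k t → isNode (insertLeftmost k t) ≡ true
isNode-insertLeftmost k leaf = refl
isNode-insertLeftmost k t@(node _ _) with size t ≤? k
... | yes _ = refl
... | no _ = refl

insertLeftmost-bounds : ∀ {l r k} → firstLetter (node l r) ≤ k → k < size (node l r) →
                        firstLetter l ≤ k ∸ size r × k ∸ size r ≤ size l
insertLeftmost-bounds {l} {r} {k} fl≤k k<size =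
  m+n≤o⇒m≤o∸n (firstLetter l) fl≤k ,
  m≤n+o⇒m∸n≤o k (size r) (subst (k ≤_) (+-comm (size l) (size r)) (s≤s⁻¹ k<size))

firstLetter-insertLeftmost : ∀ k t → firstLetter t ≤ k → k ≤ size t → firstLetter (insertLeftmost k t) ≡ k
firstLetter-insertLeftmost .zero leaf _ z≤n = refl
firstLetter-insertLeftmost k t@(node l r) fl≤k k≤size with size t ≤? k
... | yes size≤k = ≤-antisym size≤k k≤size
... | no size≰k = begin
  firstLetter (insertLeftmost (k ∸ size r) l) + size r
    ≡⟨ cong (_+ size r) (firstLetter-insertLeftmost (k ∸ size r) l lower upper) ⟩
  k ∸ size r + size r
    ≡⟨ m∸n+n≡m (m+n≤o⇒n≤o (firstLetter l) fl≤k) ⟩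
  k ∎
  where
  open ≡-Reasoning
  lower : firstLetter l ≤ k ∸ size r
  lower = proj₁ (insertLeftmost-bounds {l} {r} fl≤k (≰⇒> size≰k))
  upper : k ∸ size r ≤ size l
  upper = proj₂ (insertLeftmost-bounds {l} {r} fl≤k (≰⇒> size≰k))

dropLeftmost-insertLeftmost : ∀ k t → firstLetter t ≤ k → k ≤ size t → dropLeftmost (insertLeftmost k t) ≡ t
dropLeftmost-insertLeftmost k leaf _ _ = refl
dropLeftmost-insertLeftmost k t@(node l r) fl≤k k≤size with size t ≤? k
... | yes _ = refl
... | no size≰k = begin
  dropLeftmost (node (insertLeftmost (k ∸ size r) l) r)
    ≡⟨ dropLeftmost-node _ r (isNode-insertLeftmost (k ∸ size r) l) ⟩
  node (dropLeftmost (insertLeftmost (k ∸ size r) l)) r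
    ≡⟨ cong (λ l′ → node l′ r) (dropLeftmost-insertLeftmost (k ∸ size r) l lower upper) ⟩
  node l r ∎
  where
  open ≡-Reasoning
  lower : firstLetter l ≤ k ∸ size r
  lower = proj₁ (insertLeftmost-bounds {l} {r} fl≤k (≰⇒> size≰k))
  upper : k ∸ size r ≤ size l
  upper = proj₂ (insertLeftmost-bounds {l} {r} fl≤k (≰⇒> size≰k))

insertLeftmost-dropLeftmost : ∀ l r → insertLeftmost (firstLetter (node l r)) (dropLeftmost (node l r)) ≡ node l r
insertLeftmost-dropLeftmost leaf leaf = refl
insertLeftmost-dropLeftmost leaf r@(node _ _) with size r ≤? size r
... | yes _ = refl
... | no size≰size = contradiction ≤-refl size≰size
insertLeftmost-dropLeftmost l@(node a b) r with size (node (dropLeftmost l) r) ≤? firstLetter l + size r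
... | yes size≤k = contradiction size≤k (<⇒≱ firstLetter<size′)
  where
  firstLetter<size′ : firstLetter l + size r < size (node (dropLeftmost l) r)
  firstLetter<size′ rewrite size-dropLeftmost l = +-monoˡ-< (size r) (firstLetter<size a b)
... | no _ = cong (λ l′ → node l′ r) (begin
  insertLeftmost (firstLetter l + size r ∸ size r) (dropLeftmost l)
    ≡⟨ cong (λ k → insertLeftmost k (dropLeftmost l)) (m+n∸n≡m (firstLetter l) (size r)) ⟩
  insertLeftmost (firstLetter l) (dropLeftmost l)
    ≡⟨ insertLeftmost-dropLeftmost a b ⟩
  l ∎)
  where open ≡-Reasoning

treeWord-bounded : ∀ t {n i} → size t ≡ n → i < n → treeWord t i < n
treeWord-bounded (node l r) {i = zero} refl _ = firstLetter<size l r
treeWord-bounded t@(node _ _) {suc n} {suc i} size≡ i<1+n =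
  punchIn-bounded (firstLetter t)
    (treeWord-bounded (dropLeftmost t) (trans (size-dropLeftmost t) (cong pred size≡)) (s<s⁻¹ i<1+n))

treeWord-injective : ∀ t {i j} → treeWord t i ≡ treeWord t j → i ≡ j
treeWord-injective t {zero} {zero} _ = refl
treeWord-injective t {zero} {suc j} eq = contradiction (sym eq) (punchInᵢ≢i (firstLetter t) _)
treeWord-injective t {suc i} {zero} eq = contradiction eq (punchInᵢ≢i (firstLetter t) _)
treeWord-injective t {suc i} {suc j} eq =
  cong suc (treeWord-injective (dropLeftmost t) (punchIn-injective (firstLetter t) eq))

treeWord-avoids132 : ∀ t {i j k} → i < j → j < k →
                     treeWord t i < treeWord t k → treeWord t k < treeWord t j → ⊥
treeWord-avoids132 t {suc i} {suc j} {suc k} i<j j<k p q =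
  treeWord-avoids132 (dropLeftmost t) (s≤s⁻¹ i<j) (s≤s⁻¹ j<k)
    (punchIn-cancel-< (firstLetter t) p) (punchIn-cancel-< (firstLetter t) q)
treeWord-avoids132 t {zero} {suc j} {suc k} _ j<k p q =
  pattern-from-second j (s≤s⁻¹ j<k) (punchIn-cancel-< (firstLetter t) q)
  where
  t′ : Tree
  t′ = dropLeftmost t
  -- The second letter is at most one above the first, so it lies below every later letter
  -- that is above the first.
  second≤later : firstLetter t′ ≤ treeWord t′ k
  second≤later = ≤-trans (firstLetter-dropLeftmost t) (pivot<punchIn⇒pivot≤ _ _ p)
  pattern-from-second : ∀ j → j < k → treeWord t′ k < treeWord t′ j → ⊥
  pattern-from-second zero _ later<second = <⇒≱ later<second second≤later
  pattern-from-second (suc j) j<k later<middle =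
    treeWord-avoids132 t′ z<s j<k (≤∧≢⇒< second≤later (λ eq → <⇒≢ (≤-<-trans z≤n j<k) (treeWord-injective t′ eq))) later<middle

-- Descents are right children

inorderFlags : (Tree → Tree → Bool) → Tree → List Bool
inorderFlags f leaf = []
inorderFlags f (node l r) = inorderFlags f l ++ f l r ∷ inorderFlags f r

rightFlags : Tree → List Bool
rightFlags = inorderFlags (λ _ r → isNode r)

leftFlags : Tree → List Bool
leftFlags = inorderFlags (λ l _ → isNode l)

infixl 5 _!_
_!_ : List Bool → ℕ → Bool
[] ! _ = false
(b ∷ _) ! zero = b
(_ ∷ bs) ! suc i = bs ! i

hasRightChild : Tree → ℕ → Bool
hasRightChild t i = rightFlags t ! i

leftmostHasRightChild : Tree → Bool
leftmostHasRightChild leaf = false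
leftmostHasRightChild (node leaf r) = isNode r
leftmostHasRightChild (node l@(node _ _) r) = leftmostHasRightChild l

rightFlags-node : ∀ l r →
                  rightFlags (node l r) ≡ leftmostHasRightChild (node l r) ∷ rightFlags (dropLeftmost (node l r))
rightFlags-node leaf r = refl
rightFlags-node (node a b) r = cong (_++ isNode r ∷ rightFlags r) (rightFlags-node a b)

hasRightChild-suc : ∀ t i → hasRightChild t (suc i) ≡ hasRightChild (dropLeftmost t) i
hasRightChild-suc leaf i = refl
hasRightChild-suc (node l r) i = cong (_! suc i) (rightFlags-node l r)

hasRightChild-zero : ∀ t → hasRightChild t 0 ≡ leftmostHasRightChild t
hasRightChild-zero leaf = refl
hasRightChild-zero (node l r) = cong (_! 0) (rightFlags-node l r)

leftmostHasRightChild⇔ : ∀ t → leftmostHasRightChild t ≡ true ⇔ firstLetter (dropLeftmost t) < firstLetter t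
leftmostHasRightChild⇔ t = mk⇔ (to t) (from t)
  where
  to : ∀ t → leftmostHasRightChild t ≡ true → firstLetter (dropLeftmost t) < firstLetter t
  to (node leaf (node a b)) _ = firstLetter<size a b
  to (node l@(node _ _) r) h = +-monoˡ-< (size r) (to l h)
  from : ∀ t → firstLetter (dropLeftmost t) < firstLetter t → leftmostHasRightChild t ≡ true
  from (node leaf leaf) ()
  from (node leaf (node a b)) _ = refl
  from (node l@(node _ _) r) p = from l (+-cancelʳ-< _ _ _ p)

treeWord-descent⇔ : ∀ t i → treeWord t (suc i) < treeWord t i ⇔ hasRightChild t i ≡ true
treeWord-descent⇔ t zero = begin
  punchIn (firstLetter t) (firstLetter (dropLeftmost t)) < firstLetter t
    ≈⟨ punchIn<pivot⇔ (firstLetter t) _ ⟩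
  firstLetter (dropLeftmost t) < firstLetter t
    ≈⟨ leftmostHasRightChild⇔ t ⟨
  leftmostHasRightChild t ≡ true
    ≡⟨ cong (_≡ true) (hasRightChild-zero t) ⟨
  hasRightChild t 0 ≡ true ∎
  where open ⇔-Reasoning
treeWord-descent⇔ t (suc i) = begin
  punchIn (firstLetter t) (treeWord (dropLeftmost t) (suc i)) < punchIn (firstLetter t) (treeWord (dropLeftmost t) i)
    ≈⟨ punchIn-<⇔ (firstLetter t) ⟩
  treeWord (dropLeftmost t) (suc i) < treeWord (dropLeftmost t) i
    ≈⟨ treeWord-descent⇔ (dropLeftmost t) i ⟩
  hasRightChild (dropLeftmost t) i ≡ true
    ≡⟨ cong (_≡ true) (hasRightChild-suc t i) ⟨
  hasRightChild t (suc i) ≡ true ∎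
  where open ⇔-Reasoning

isNode-mirror : ∀ t → isNode (mirror t) ≡ isNode t
isNode-mirror leaf = refl
isNode-mirror (node _ _) = refl

rightFlags-mirror : ∀ t → rightFlags (mirror t) ≡ reverse (leftFlags t)
rightFlags-mirror leaf = refl
rightFlags-mirror (node l r) = begin
  rightFlags (mirror r) ++ isNode (mirror l) ∷ rightFlags (mirror l)
    ≡⟨ cong₂ _++_ (rightFlags-mirror r) (cong₂ _∷_ (isNode-mirror l) (rightFlags-mirror l)) ⟩
  reverse (leftFlags r) ++ isNode l ∷ reverse (leftFlags l)
    ≡⟨ ++-assoc (reverse (leftFlags r)) (isNode l ∷ []) (reverse (leftFlags l)) ⟨
  (reverse (leftFlags r) ++ isNode l ∷ []) ++ reverse (leftFlags l)
    ≡⟨ cong (_++ reverse (leftFlags l)) (unfold-reverse (isNode l) (leftFlags r)) ⟨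
  reverse (isNode l ∷ leftFlags r) ++ reverse (leftFlags l)
    ≡⟨ reverse-++ (leftFlags l) (isNode l ∷ leftFlags r) ⟨
  reverse (leftFlags l ++ isNode l ∷ leftFlags r) ∎
  where open ≡-Reasoning

-- In in-order, a node has a left child iff its predecessor has no right child.
leftFlags-rightFlags : ∀ t bs → false ∷ map not (rightFlags t) ++ bs ≡ leftFlags t ++ isNode t ∷ bs
leftFlags-rightFlags leaf bs = refl
leftFlags-rightFlags (node l r) bs = begin
  false ∷ map not (rightFlags l ++ isNode r ∷ rightFlags r) ++ bs
    ≡⟨ cong (λ xs → false ∷ xs ++ bs) (map-++ not (rightFlags l) (isNode r ∷ rightFlags r)) ⟩
  false ∷ (map not (rightFlags l) ++ not (isNode r) ∷ map not (rightFlags r)) ++ bs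
    ≡⟨ cong (false ∷_) (++-assoc (map not (rightFlags l)) _ bs) ⟩
  false ∷ map not (rightFlags l) ++ not (isNode r) ∷ map not (rightFlags r) ++ bs
    ≡⟨ leftFlags-rightFlags l _ ⟩
  leftFlags l ++ isNode l ∷ not (isNode r) ∷ map not (rightFlags r) ++ bs
    ≡⟨ cong (λ xs → leftFlags l ++ isNode l ∷ xs) (rightSubtree r (leftFlags-rightFlags r bs)) ⟩
  leftFlags l ++ isNode l ∷ leftFlags r ++ true ∷ bs
    ≡⟨ ++-assoc (leftFlags l) _ _ ⟨
  (leftFlags l ++ isNode l ∷ leftFlags r) ++ true ∷ bs ∎
  where
  open ≡-Reasoning
  rightSubtree : ∀ r → false ∷ map not (rightFlags r) ++ bs ≡ leftFlags r ++ isNode r ∷ bs →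
                 not (isNode r) ∷ map not (rightFlags r) ++ bs ≡ leftFlags r ++ true ∷ bs
  rightSubtree leaf _ = refl
  rightSubtree (node _ _) eq = eq

length-inorderFlags : ∀ f t → length (inorderFlags f t) ≡ size t
length-inorderFlags f leaf = refl
length-inorderFlags f (node l r) = begin
  length (inorderFlags f l ++ f l r ∷ inorderFlags f r)
    ≡⟨ length-++ (inorderFlags f l) ⟩
  length (inorderFlags f l) + suc (length (inorderFlags f r))
    ≡⟨ cong₂ (λ a b → a + suc b) (length-inorderFlags f l) (length-inorderFlags f r) ⟩
  size l + suc (size r)
    ≡⟨ +-suc (size l) (size r) ⟩
  suc (size l + size r) ∎
  where open ≡-Reasoning

!-++ˡ : ∀ xs ys {i} → i < length xs → (xs ++ ys) ! i ≡ xs ! i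
!-++ˡ (x ∷ xs) ys {zero} _ = refl
!-++ˡ (x ∷ xs) ys {suc i} i<len = !-++ˡ xs ys (s<s⁻¹ i<len)

!-++-length : ∀ xs y ys → (xs ++ y ∷ ys) ! length xs ≡ y
!-++-length [] y ys = refl
!-++-length (x ∷ xs) y ys = !-++-length xs y ys

!-map-not : ∀ xs {i} → i < length xs → map not xs ! i ≡ not (xs ! i)
!-map-not (x ∷ xs) {zero} _ = refl
!-map-not (x ∷ xs) {suc i} i<len = !-map-not xs (s<s⁻¹ i<len)

!-reverse : ∀ xs {i} → i < length xs → reverse xs ! i ≡ xs ! (length xs ∸ suc i)
!-reverse (x ∷ xs) {i} i<len rewrite unfold-reverse x xs with <-cmp i (length xs)
... | tri< i<len′ _ _ = begin
  (reverse xs ++ x ∷ []) ! i       ≡⟨ !-++ˡ (reverse xs) _ (subst (i <_) (sym (length-reverse xs)) i<len′) ⟩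
  reverse xs ! i                   ≡⟨ !-reverse xs i<len′ ⟩
  (x ∷ xs) ! suc (length xs ∸ suc i) ≡⟨ cong ((x ∷ xs) !_) (+-∸-assoc 1 i<len′) ⟨
  (x ∷ xs) ! (length xs ∸ i)       ∎
  where open ≡-Reasoning
... | tri≈ _ refl _ = begin
  (reverse xs ++ x ∷ []) ! length xs ≡⟨ cong ((reverse xs ++ x ∷ []) !_) (length-reverse xs) ⟨
  (reverse xs ++ x ∷ []) ! length (reverse xs) ≡⟨ !-++-length (reverse xs) x [] ⟩
  x ≡⟨ cong ((x ∷ xs) !_) (n∸n≡0 (length xs)) ⟨
  (x ∷ xs) ! (length xs ∸ length xs) ∎
  where open ≡-Reasoning
... | tri> _ _ len<i = contradiction i<len (<⇒≱ (s≤s len<i))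

hasRightChild-mirror : ∀ t {N m} → size t ≡ suc N → m < N →
                       hasRightChild (mirror t) m ≡ not (hasRightChild t (N ∸ suc m))
hasRightChild-mirror t {N} {m} size≡ m<N = begin
  rightFlags (mirror t) ! m
    ≡⟨ cong (_! m) (rightFlags-mirror t) ⟩
  reverse (leftFlags t) ! m
    ≡⟨ !-reverse (leftFlags t) (length< (m<n⇒m<1+n m<N)) ⟩
  leftFlags t ! (length (leftFlags t) ∸ suc m)
    ≡⟨ cong (λ len → leftFlags t ! (len ∸ suc m)) (trans (length-inorderFlags _ t) size≡) ⟩
  leftFlags t ! (N ∸ m)
    ≡⟨ cong (leftFlags t !_) (+-∸-assoc 1 m<N) ⟩
  leftFlags t ! suc j
    ≡⟨ !-++ˡ (leftFlags t) (isNode t ∷ []) (length< (s≤s j<N)) ⟨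
  (leftFlags t ++ isNode t ∷ []) ! suc j
    ≡⟨ cong (_! suc j) (leftFlags-rightFlags t []) ⟨
  (map not (rightFlags t) ++ []) ! j
    ≡⟨ cong (_! j) (++-identityʳ (map not (rightFlags t))) ⟩
  map not (rightFlags t) ! j
    ≡⟨ !-map-not (rightFlags t) (length< (m<n⇒m<1+n j<N)) ⟩
  not (rightFlags t ! j) ∎
  where
  open ≡-Reasoning
  j : ℕ
  j = N ∸ suc m
  j<N : j < N
  j<N = ∸-monoʳ-< z<s m<N
  length< : ∀ {f i} → i < suc N → i < length (inorderFlags f t)
  length< {f} = subst (_ <_) (sym (trans (length-inorderFlags f t) size≡))

-- Decoding 132-avoiding words

record Avoiding132Perm (n : ℕ) (f : ℕ → ℕ) : Set where
  field
    bounded    : ∀ {i} → i < n → f i < n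
    injective  : ∀ {i j} → i < n → j < n → f i ≡ f j → i ≡ j
    surjective : ∀ {v} → v < n → ∃[ i ] (i < n × f i ≡ v)
    avoids132  : ∀ {i j k} → i < j → j < k → k < n → f i < f k → f k < f j → ⊥

dropFirstLetter : (ℕ → ℕ) → ℕ → ℕ
dropFirstLetter f i = punchOut (f 0) (f (suc i))

module _ {n f} (π : Avoiding132Perm (suc n) f) where
  open Avoiding132Perm π

  laterLetter≢firstLetter : ∀ {i} → i < n → f (suc i) ≢ f 0
  laterLetter≢firstLetter i<n eq with injective (s≤s i<n) z<s eq
  ... | ()

  punchIn-dropFirstLetter : ∀ {i} → i < n → punchIn (f 0) (dropFirstLetter f i) ≡ f (suc i)
  punchIn-dropFirstLetter {i} i<n = punchIn-punchOut (f 0) (f (suc i)) (laterLetter≢firstLetter i<n)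

  dropFirstLetter-avoiding : Avoiding132Perm n (dropFirstLetter f)
  dropFirstLetter-avoiding = record
    { bounded = λ i<n → punchOut-bounded (bounded z<s) (bounded (s≤s i<n)) (laterLetter≢firstLetter i<n)
    ; injective = λ i<n j<n eq → suc-injective (injective (s≤s i<n) (s≤s j<n)
        (trans (sym (punchIn-dropFirstLetter i<n)) (trans (cong (punchIn (f 0)) eq) (punchIn-dropFirstLetter j<n))))
    ; surjective = surjective′
    ; avoids132 = λ i<j j<k k<n p q → avoids132 (s≤s i<j) (s≤s j<k) (s≤s k<n)
        (subst₂ _<_ (punchIn-dropFirstLetter (<-trans i<j (<-trans j<k k<n))) (punchIn-dropFirstLetter k<n)
          (punchIn-mono-< (f 0) p))
        (subst₂ _<_ (punchIn-dropFirstLetter k<n) (punchIn-dropFirstLetter (<-trans j<k k<n))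
          (punchIn-mono-< (f 0) q))
    }
    where
    surjective′ : ∀ {v} → v < n → ∃[ i ] (i < n × dropFirstLetter f i ≡ v)
    surjective′ {v} v<n with surjective (punchIn-bounded (f 0) v<n)
    ... | zero , _ , eq = contradiction (sym eq) (punchInᵢ≢i (f 0) v)
    ... | suc i , i<1+n , eq = i , s<s⁻¹ i<1+n , trans (cong (punchOut (f 0)) eq) (punchOut-punchIn (f 0) v)

  secondLetter≤ : 0 < n → f 1 ≤ suc (f 0)
  secondLetter≤ 0<n with f 1 ≤? suc (f 0)
  ... | yes f₁≤ = f₁≤
  ... | no f₁≰ with surjective (<-trans (≰⇒> f₁≰) (bounded (s≤s 0<n)))
  ...   | zero , _ , eq = contradiction eq (<⇒≢ (n<1+n (f 0)))
  ...   | suc zero , _ , eq = contradiction (subst (suc (f 0) <_) eq (≰⇒> f₁≰)) (<-irrefl refl)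
  ...   | suc (suc i) , i<1+n , eq = ⊥-elim $
    avoids132 z<s (s≤s z<s) i<1+n (subst (f 0 <_) (sym eq) (n<1+n (f 0))) (subst (_< f 1) (sym eq) (≰⇒> f₁≰))

fromWord : ℕ → (ℕ → ℕ) → Tree
fromWord zero f = leaf
fromWord (suc n) f = insertLeftmost (f 0) (fromWord n (dropFirstLetter f))

size-fromWord : ∀ n f → size (fromWord n f) ≡ n
size-fromWord zero f = refl
size-fromWord (suc n) f = trans (size-insertLeftmost (f 0) _) (cong suc (size-fromWord n _))

fromWord-cong : ∀ n {f g} → (∀ {i} → i < n → f i ≡ g i) → fromWord n f ≡ fromWord n g
fromWord-cong zero _ = refl
fromWord-cong (suc n) {f} {g} f≗g rewrite f≗g z<s =
  cong (insertLeftmost (g 0)) (fromWord-cong n (λ i<n → cong (punchOut (g 0)) (f≗g (s≤s i<n))))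

fromWord-treeWord : ∀ n t → size t ≡ n → fromWord n (treeWord t) ≡ t
fromWord-treeWord zero leaf _ = refl
fromWord-treeWord (suc n) t@(node l r) size≡ = begin
  insertLeftmost (firstLetter t) (fromWord n (dropFirstLetter (treeWord t)))
    ≡⟨ cong (insertLeftmost (firstLetter t)) (fromWord-cong n (λ _ → punchOut-punchIn (firstLetter t) _)) ⟩
  insertLeftmost (firstLetter t) (fromWord n (treeWord (dropLeftmost t)))
    ≡⟨ cong (insertLeftmost (firstLetter t))
            (fromWord-treeWord n (dropLeftmost t) (trans (size-dropLeftmost t) (cong pred size≡))) ⟩
  insertLeftmost (firstLetter t) (dropLeftmost t)
    ≡⟨ insertLeftmost-dropLeftmost l r ⟩
  t ∎
  where open ≡-Reasoning

firstLetter-fromWord≤ : ∀ n {g k} → (∀ {i} → i < n → treeWord (fromWord n g) i ≡ g i) → (0 < n → g 0 ≤ k) →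
                        firstLetter (fromWord n g) ≤ k
firstLetter-fromWord≤ zero _ _ = z≤n
firstLetter-fromWord≤ (suc n) word≡ g₀≤k = subst (_≤ _) (sym (word≡ z<s)) (g₀≤k z<s)

treeWord-fromWord : ∀ n {f} → Avoiding132Perm n f → ∀ {i} → i < n → treeWord (fromWord n f) i ≡ f i
treeWord-fromWord (suc n) {f} π {i} i<1+n = go i<1+n
  where
  k : ℕ
  k = f 0
  t′ : Tree
  t′ = fromWord n (dropFirstLetter f)
  word≡ : ∀ {i} → i < n → treeWord t′ i ≡ dropFirstLetter f i
  word≡ = treeWord-fromWord n (dropFirstLetter-avoiding π)
  lower : firstLetter t′ ≤ k
  lower = firstLetter-fromWord≤ n word≡ (λ 0<n → punchOut-≤-pivot k (f 1) (secondLetter≤ π 0<n))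
  upper : k ≤ size t′
  upper = subst (k ≤_) (sym (size-fromWord n _)) (s≤s⁻¹ (Avoiding132Perm.bounded π z<s))
  go : ∀ {i} → i < suc n → treeWord (insertLeftmost k t′) i ≡ f i
  go {zero} _ = firstLetter-insertLeftmost k t′ lower upper
  go {suc i} i<1+n = begin
    punchIn (firstLetter (insertLeftmost k t′)) (treeWord (dropLeftmost (insertLeftmost k t′)) i)
      ≡⟨ cong₂ (λ a t → punchIn a (treeWord t i)) (firstLetter-insertLeftmost k t′ lower upper)
                                                  (dropLeftmost-insertLeftmost k t′ lower upper) ⟩
    punchIn k (treeWord t′ i)
      ≡⟨ cong (punchIn k) (word≡ (s<s⁻¹ i<1+n)) ⟩
    punchIn k (dropFirstLetter f i)
      ≡⟨ punchIn-dropFirstLetter π (s<s⁻¹ i<1+n) ⟩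
    f (suc i) ∎
    where open ≡-Reasoning

lookupℕ : ∀ {m k} → Vec (Fin m) k → ℕ → ℕ
lookupℕ [] _ = 0
lookupℕ (a ∷ _) zero = toℕ a
lookupℕ (_ ∷ as) (suc i) = lookupℕ as i

lookupℕ-toℕ : ∀ {m k} (w : Vec (Fin m) k) j → lookupℕ w (toℕ j) ≡ toℕ (lookup w j)
lookupℕ-toℕ (a ∷ _) Fin.zero = refl
lookupℕ-toℕ (_ ∷ as) (Fin.suc j) = lookupℕ-toℕ as j

lookupℕ-fromℕ< : ∀ {m k} (w : Vec (Fin m) k) {i} (i<k : i < k) → lookupℕ w i ≡ toℕ (lookup w (fromℕ< i<k))
lookupℕ-fromℕ< w {i} i<k =
  subst (λ i′ → lookupℕ w i′ ≡ toℕ (lookup w (fromℕ< i<k)))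
    (toℕ-fromℕ< i<k) (lookupℕ-toℕ w (fromℕ< i<k))

IsPerm-surjective : ∀ {n} (w : Vec (Fin n) n) → IsPerm w → ∀ v → ∃[ i ] lookup w i ≡ v
IsPerm-surjective {suc m} w w-injective v with any? (λ i → lookup w i Fin.≟ v)
... | yes found = found
... | no missing = contradiction (injective⇒≤ avoiding-injective) (<⇒≱ (n<1+n m))
  where
  avoiding : Fin (suc m) → Fin m
  avoiding i = Fin.punchOut {i = v} {j = lookup w i} (λ eq → missing (i , sym eq))
  avoiding-injective : ∀ {i j} → avoiding i ≡ avoiding j → i ≡ j
  avoiding-injective {i} {j} eq =
    w-injective i j (punchOut-injective (λ eq → missing (i , sym eq)) (λ eq → missing (j , sym eq)) eq)

perm-avoiding132 : ∀ {n} (w : Vec (Fin n) n) → IsPerm w → Avoids132 w → Avoiding132Perm n (lookupℕ w)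
perm-avoiding132 {n} w w-perm w-avoids = record
  { bounded = λ i<n → subst (_< n) (sym (lookupℕ-fromℕ< w i<n)) (toℕ<n _)
  ; injective = λ i<n j<n eq → trans (sym (toℕ-fromℕ< i<n)) (trans
      (cong toℕ (w-perm _ _ (toℕ-injective
        (trans (sym (lookupℕ-fromℕ< w i<n)) (trans eq (lookupℕ-fromℕ< w j<n))))))
      (toℕ-fromℕ< j<n))
  ; surjective = surjective
  ; avoids132 = avoids132
  }
  where
  surjective : ∀ {v} → v < n → ∃[ i ] (i < n × lookupℕ w i ≡ v)
  surjective v<n with IsPerm-surjective w w-perm (fromℕ< v<n)
  ... | i , eq = toℕ i , toℕ<n i , trans (lookupℕ-toℕ w i) (trans (cong toℕ eq) (toℕ-fromℕ< v<n))
  avoids132 : ∀ {i j k} → i < j → j < k → k < n →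
              lookupℕ w i < lookupℕ w k → lookupℕ w k < lookupℕ w j → ⊥
  avoids132 {i} {j} {k} i<j j<k k<n p q = w-avoids
    ( fromℕ< i<n , fromℕ< j<n , fromℕ< k<n
    , subst₂ _<_ (sym (toℕ-fromℕ< i<n)) (sym (toℕ-fromℕ< j<n)) i<j
    , subst₂ _<_ (sym (toℕ-fromℕ< j<n)) (sym (toℕ-fromℕ< k<n)) j<k
    , subst₂ _<_ (lookupℕ-fromℕ< w i<n) (lookupℕ-fromℕ< w k<n) p
    , subst₂ _<_ (lookupℕ-fromℕ< w k<n) (lookupℕ-fromℕ< w j<n) q )
    where
    j<n : j < n
    j<n = <-trans j<k k<n
    i<n : i < n
    i<n = <-trans i<j j<n

module _ {n : ℕ} where

  tree : P n → Tree
  tree x = fromWord n (lookupℕ (word x))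

  size-tree : ∀ x → size (tree x) ≡ n
  size-tree x = size-fromWord n _

  toℕ-word-tree : ∀ x j → toℕ (lookup (word x) j) ≡ treeWord (tree x) (toℕ j)
  toℕ-word-tree x@(mkP w w-perm w-avoids) j = begin
    toℕ (lookup w j)            ≡⟨ lookupℕ-toℕ w j ⟨
    lookupℕ w (toℕ j)           ≡⟨ treeWord-fromWord n avoiding (toℕ<n j) ⟨
    treeWord (tree x) (toℕ j)   ∎
    where
    open ≡-Reasoning
    avoiding : Avoiding132Perm n (lookupℕ w)
    avoiding = perm-avoiding132 w (λ i j eq → recompute (i Fin.≟ j) (w-perm i j eq)) (¬-recompute w-avoids)

  P-≡ : ∀ {x y : P n} → (∀ j → toℕ (lookup (word x) j) ≡ toℕ (lookup (word y) j)) → x ≡ y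
  P-≡ {mkP u _ _} {mkP w _ _} u≗w = mkP-cong (begin
    u                   ≡⟨ tabulate∘lookup u ⟨
    tabulate (lookup u) ≡⟨ tabulate-cong (λ j → toℕ-injective (u≗w j)) ⟩
    tabulate (lookup w) ≡⟨ tabulate∘lookup w ⟩
    w                   ∎)
    where
    open ≡-Reasoning
    mkP-cong : ∀ {u w} .{pu au pw aw} → u ≡ w → mkP u pu au ≡ mkP w pw aw
    mkP-cong refl = refl

module _ {n : ℕ} (t : Tree) (size≡ : size t ≡ n) where

  private
    letter< : ∀ (j : Fin n) → treeWord t (toℕ j) < n
    letter< j = treeWord-bounded t size≡ (toℕ<n j)

    treeVec : Vec (Fin n) n
    treeVec = tabulate (λ j → fromℕ< (letter< j))

    toℕ-treeVec : ∀ j → toℕ (lookup treeVec j) ≡ treeWord t (toℕ j)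
    toℕ-treeVec j = trans (cong toℕ (lookup∘tabulate _ j)) (toℕ-fromℕ< (letter< j))

  fromTree : P n
  fromTree = mkP treeVec
    (λ i j eq → toℕ-injective (treeWord-injective t
      (trans (sym (toℕ-treeVec i)) (trans (cong toℕ eq) (toℕ-treeVec j)))))
    (λ (i , j , k , i<j , j<k , p , q) → treeWord-avoids132 t i<j j<k
      (subst₂ _<_ (toℕ-treeVec i) (toℕ-treeVec k) p) (subst₂ _<_ (toℕ-treeVec k) (toℕ-treeVec j) q))

  toℕ-word-fromTree : ∀ j → toℕ (lookup (word fromTree) j) ≡ treeWord t (toℕ j)
  toℕ-word-fromTree = toℕ-treeVec

  tree-fromTree : tree fromTree ≡ t
  tree-fromTree = begin
    fromWord n (lookupℕ (word fromTree))  ≡⟨ fromWord-cong n letter≡ ⟩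
    fromWord n (treeWord t)               ≡⟨ fromWord-treeWord n t size≡ ⟩
    t                                     ∎
    where
    open ≡-Reasoning
    letter≡ : ∀ {i} → i < n → lookupℕ (word fromTree) i ≡ treeWord t i
    letter≡ i<n = trans (lookupℕ-fromℕ< (word fromTree) i<n)
                        (trans (toℕ-treeVec _) (cong (treeWord t) (toℕ-fromℕ< i<n)))

-- The anti-automorphism

module _ {N : ℕ} where

  descentSet : P (suc N) → Pred ℕ 0ℓ
  descentSet x = support N (hasRightChild (tree x))

  inDescent≐ : ∀ x → InDescent (word x) ≐′ (toℕ ⊢ descentSet x)
  inDescent≐ x = to , from
    where
    letter : ∀ {j m} → toℕ j ≡ m → toℕ (lookup (word x) j) ≡ treeWord (tree x) m
    letter {j} refl = toℕ-word-tree x j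
    to : InDescent (word x) ⊆′ (toℕ ⊢ descentSet x)
    to i (j , j≡1+i , wj<wi) =
      s<s⁻¹ (subst (_< suc N) j≡1+i (toℕ<n j)) ,
      Equivalence.to (treeWord-descent⇔ (tree x) (toℕ i)) (subst₂ _<_ (letter j≡1+i) (letter refl) wj<wi)
    from : (toℕ ⊢ descentSet x) ⊆′ InDescent (word x)
    from i (i<N , hasRight) =
      fromℕ< (s≤s i<N) , toℕ-fromℕ< (s≤s i<N) ,
      subst₂ _<_ (sym (letter (toℕ-fromℕ< (s≤s i<N)))) (sym (letter refl))
        (Equivalence.from (treeWord-descent⇔ (tree x) (toℕ i)) hasRight)

  <P⇔⊊ : ∀ x y → x <P y ⇔ descentSet x ⊊ descentSet y
  <P⇔⊊ x y = begin
    x <P y                                      ≈⟨ ⊊-cong (inDescent≐ x) (inDescent≐ y) ⟩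
    (toℕ ⊢ descentSet x) ⊊ (toℕ ⊢ descentSet y) ≈⟨ ⊊-preimage⇔ toℕ (inImage x) (inImage y) ⟩
    descentSet x ⊊ descentSet y                 ∎
    where
    open ⇔-Reasoning
    inImage : ∀ x m → descentSet x m → ∃ λ (i : Fin (suc N)) → toℕ i ≡ m
    inImage x m (m<N , _) = fromℕ< (m<n⇒m<1+n m<N) , toℕ-fromℕ< _

  size-mirror-tree : ∀ x → size (mirror (tree x)) ≡ suc N
  size-mirror-tree x = trans (size-mirror (tree x)) (size-tree x)

  φ : P (suc N) → P (suc N)
  φ x = fromTree (mirror (tree x)) (size-mirror-tree x)

  tree-φ : ∀ x → tree (φ x) ≡ mirror (tree x)
  tree-φ x = tree-fromTree (mirror (tree x)) (size-mirror-tree x)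

  φ-involutive : ∀ x → φ (φ x) ≡ x
  φ-involutive x = P-≡ λ j → begin
    toℕ (lookup (word (φ (φ x))) j)
      ≡⟨ toℕ-word-fromTree (mirror (tree (φ x))) (size-mirror-tree (φ x)) j ⟩
    treeWord (mirror (tree (φ x))) (toℕ j)     ≡⟨ cong (λ t → treeWord (mirror t) (toℕ j)) (tree-φ x) ⟩
    treeWord (mirror (mirror (tree x))) (toℕ j) ≡⟨ cong (λ t → treeWord t (toℕ j)) (mirror-involutive (tree x)) ⟩
    treeWord (tree x) (toℕ j)                  ≡⟨ toℕ-word-tree x j ⟨
    toℕ (lookup (word x) j)                    ∎
    where open ≡-Reasoning

  descentSet-φ : ∀ x → descentSet (φ x) ≐′ support N (reflect N (hasRightChild (tree x)))
  descentSet-φ x = support-cong λ {m} m<N →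
    trans (cong (λ t → hasRightChild t m) (tree-φ x)) (hasRightChild-mirror (tree x) (size-tree x) m<N)

  φ-antitone : ∀ x y → x <P y ⇔ φ y <P φ x
  φ-antitone x y = begin
    x <P y                                       ≈⟨ <P⇔⊊ x y ⟩
    descentSet x ⊊ descentSet y                  ≈⟨ reflect-⊊⇔ ⟩
    support N (reflect N (hasRightChild (tree y))) ⊊ support N (reflect N (hasRightChild (tree x)))
                                                 ≈⟨ ⊊-cong (descentSet-φ y) (descentSet-φ x) ⟨
    descentSet (φ y) ⊊ descentSet (φ x)          ≈⟨ <P⇔⊊ (φ y) (φ x) ⟨
    φ y <P φ x                                   ∎
    where open ⇔-Reasoning

mainTheorem5 : (n : ℕ) → n ≥ 1 → SelfDual n
mainTheorem5 zero ()
mainTheorem5 (suc N) _ = ↔⇒⤖ (mk↔ₛ′ φ φ φ-involutive φ-involutive) , φ-antitone
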